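{- Let $n\ge2$ and let $S,T$ be nonempty subsets of $\{1,\ldots,n-1\}$ with $\max S+\min T\le n$ and $\min S+\max T\le n$; write $S=\{s_1<\cdots<s_{k_1}\}$, $T=\{t_1<\cdots<t_{k_2}\}$, and let $D$ be the digraph of $T_n\langle S;T\rangle$ and $d=\gcd\{s+t\mid s\in S,\ t\in T\}$. Then there is a positive integer $M$ such that $P_i=Q_i=R_i$ for every integer $i\ge M$.
   Context: $T_n\langle S;T\rangle$ is the $n\times n$ $(0,1)$-matrix whose $(i,j)$-entry is $1$ iff $j-i\in S$ or $i-j\in T$; its digraph $D$ has vertex set $[n]$ and an arc $(i,j)$ iff that entry is $1$. Let $\mathcal{I}_n=\{ -n+1,\ldots,n-1\}$ (integers). For a positive integer $i$: $P_i=\{\ell\in\mathcal{I}_n\mid \ell\equiv i s_1\pmod d\}$; $Q_i$ is the set of integers in $\mathcal{I}_n$ of the form $\sum_{j=1}^{k_1}a_js_j-\sum_{j=1}^{k_2}b_jt_j$ with nonnegative integers $a_j,b_j$ satisfying $\sum_j a_j+\sum_j b_j=i$; $R_i$ is the set of $\ell\in\mathcal{I}_n$ such that for all vertices $u,v\in[n]$ with $v-u=\ell$ there is a directed $(u,v)$-walk of length $i$ in $D$. -}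

module Defs where

open import Data.Nat as ℕ using (ℕ; zero; suc)
open import Data.Nat.GCD using (gcd)
open import Data.Integer as ℤ using (ℤ; +_)
open import Data.Integer.Divisibility using (_∣_)
open import Data.Fin using (Fin; toℕ; zero)
open import Data.Vec.Functional using (foldr)
open import Data.Product using (Σ; ∃; _×_)
open import Data.Sum using (_⊎_)
open import Relation.Binary.PropositionalEquality using (_≡_)

Σ[_] : ∀ {k} → (Fin k → ℕ) → ℕ
Σ[ f ] = foldr ℕ._+_ 0 f

-- S = {s 0 < ... < s k₁} (so |S| = suc k₁), T = {t 0 < ... < t k₂}.
-- Vertices of D are [n], represented by Fin n (vertex u ↔ toℕ u + 1);
-- only differences of vertices matter.

gcdST : ∀ {k₁ k₂} → (Fin k₁ → ℕ) → (Fin k₂ → ℕ) → ℕ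
gcdST s t = foldr gcd 0 (λ i → foldr gcd 0 (λ j → s i ℕ.+ t j))

vtx : ∀ {n} → Fin n → ℤ
vtx u = + toℕ u

InI : ℕ → ℤ → Set
InI n ℓ = (ℤ.- (+ n)) ℤ.< ℓ × ℓ ℤ.< + n

Arc : ∀ {n k₁ k₂} → (Fin k₁ → ℕ) → (Fin k₂ → ℕ) → Fin n → Fin n → Set
Arc s t u v = (∃ λ a → vtx v ℤ.- vtx u ≡ + s a) ⊎ (∃ λ b → vtx u ℤ.- vtx v ≡ + t b)

data Walk {n k₁ k₂} (s : Fin k₁ → ℕ) (t : Fin k₂ → ℕ) : ℕ → Fin n → Fin n → Set where
  stay : ∀ u → Walk s t 0 u u
  step : ∀ {m u w v} → Arc s t u w → Walk s t m w v → Walk s t (suc m) u v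

P : ∀ n {k₁ k₂} → (Fin (suc k₁) → ℕ) → (Fin (suc k₂) → ℕ) → ℕ → ℤ → Set
P n s t i ℓ = InI n ℓ × (+ gcdST s t) ∣ (ℓ ℤ.- + (i ℕ.* s zero))

Q : ∀ n {k₁ k₂} → (Fin k₁ → ℕ) → (Fin k₂ → ℕ) → ℕ → ℤ → Set
Q n {k₁} {k₂} s t i ℓ = InI n ℓ ×
  Σ (Fin k₁ → ℕ) λ a → Σ (Fin k₂ → ℕ) λ b →
    (Σ[ a ] ℕ.+ Σ[ b ] ≡ i) ×
    (ℓ ≡ + Σ[ (λ j → a j ℕ.* s j) ] ℤ.- + Σ[ (λ j → b j ℕ.* t j) ])

R : ∀ n {k₁ k₂} → (Fin k₁ → ℕ) → (Fin k₂ → ℕ) → ℕ → ℤ → Set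
R n s t i ℓ = InI n ℓ × (∀ (u v : Fin n) → vtx v ℤ.- vtx u ≡ ℓ → Walk s t i u v)

-- R ⊆ Q for every i: count the arcs of a walk. Q ⊆ P for every i: d divides
-- every s + t, and ℓ - i s₁ = a · (s + t₁) - b · (t + s₁) - |a| (s₁ + t₁).
-- P ⊆ R for large i: a walk can perform any prescribed list of moves +sⱼ, -tₖ
-- as long as it also has plenty of filler steps +s₁ and -t₁, which (interleaved
-- greedily, possible since s₁ + t₁ ≤ n) carry it below t₁ before each +sⱼ and
-- above n - s₁ before each -tₖ. Modulo c = s₁ + t₁, move lists reach every
-- multiple of d (Bézout, where c - 1 copies of a list negate its value) with a
-- length bounded independently of i, and the fillers make up the rest of the
-- displacement once i is large.

module Submission where

open import Defs
open import Data.Nat as ℕ using (ℕ; zero; suc; _+_; _*_; _∸_; _≤_; _<_; z≤n; s≤s; NonZero)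
import Data.Nat
open import Data.Nat.Base using (>-nonZero; >-nonZero⁻¹)
open import Data.Nat.Properties
open import Data.Nat.Divisibility using (_∣_; divides; ∣-trans; _∣0; ∣m∣n⇒∣m+n; ∣n⇒∣m*n)
open import Data.Nat.DivMod using (_/_; _%_; m≡m%n+[m/n]*n; m%n<n; m%n≤m; m/n≤m; m/n*n≤m)
open import Data.Nat.GCD using (gcd; gcd[m,n]∣m; gcd[m,n]∣n; gcd-GCD; module Bézout)
import Data.Nat.Tactic.RingSolver as ℕ-Solver
open import Data.Integer as ℤ using (ℤ; -[1+_]) renaming (+_ to pos)
import Data.Integer.Properties as ℤ
import Data.Integer.Divisibility as ℤᵘ
import Data.Integer.Divisibility.Signed as ℤˢ
import Data.Integer.Tactic.RingSolver as ℤ-Solver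
open import Data.Fin using (Fin; zero; suc; toℕ; fromℕ<; fromℕ)
import Data.Fin
open import Data.Fin.Properties using (toℕ-fromℕ<; toℕ-injective; toℕ<n; ≤fromℕ)
open import Data.Vec.Functional using (updateAt)
import Data.Vec.Functional as Vector
open import Data.List as List using (List; []; _∷_; length; replicate)
open import Data.List.Properties using (length-++; length-replicate)
open import Data.Product using (Σ; _×_; _,_; proj₁)
open import Data.Sum using (inj₁; inj₂)
open import Data.Empty using (⊥-elim)
open import Function using (_∘_)
open import Function.Bundles using (_⇔_; mk⇔)
open import Relation.Nullary using (yes; no)
open import Relation.Binary.PropositionalEquality

infix 7 _·_

_·_ : ∀ {k} → (Fin k → ℕ) → (Fin k → ℕ) → ℕ
a · w = Σ[ (λ j → a j * w j) ]

Σ-cong : ∀ {k} {f g : Fin k → ℕ} → (∀ j → f j ≡ g j) → Σ[ f ] ≡ Σ[ g ]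
Σ-cong {zero}  e = refl
Σ-cong {suc k} e = cong₂ _+_ (e zero) (Σ-cong (λ j → e (suc j)))

Σ-zero : ∀ k → Σ[ (λ (_ : Fin k) → 0) ] ≡ 0
Σ-zero zero    = refl
Σ-zero (suc k) = Σ-zero k

Σ-+ : ∀ {k} (f g : Fin k → ℕ) → Σ[ (λ j → f j + g j) ] ≡ Σ[ f ] + Σ[ g ]
Σ-+ {zero}  f g = refl
Σ-+ {suc k} f g = begin
  f zero + g zero + Σ[ (λ j → f (suc j) + g (suc j)) ]
    ≡⟨ cong (f zero + g zero +_) (Σ-+ (λ j → f (suc j)) (λ j → g (suc j))) ⟩
  f zero + g zero + (Σ[ (λ j → f (suc j)) ] + Σ[ (λ j → g (suc j)) ])
    ≡⟨ +-+-comm (f zero) (g zero) _ _ ⟩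
  f zero + Σ[ (λ j → f (suc j)) ] + (g zero + Σ[ (λ j → g (suc j)) ]) ∎
  where
  open ≡-Reasoning
  +-+-comm : ∀ a b c d → a + b + (c + d) ≡ a + c + (b + d)
  +-+-comm = ℕ-Solver.solve-∀

Σ-*ʳ : ∀ {k} (f : Fin k → ℕ) c → Σ[ (λ j → f j * c) ] ≡ Σ[ f ] * c
Σ-*ʳ {zero}  f c = refl
Σ-*ʳ {suc k} f c = trans (cong (f zero * c +_) (Σ-*ʳ (λ j → f (suc j)) c))
                         (sym (*-distribʳ-+ c (f zero) _))

·-offset : ∀ {k} (a w : Fin k → ℕ) c → a · (λ j → w j + c) ≡ a · w + Σ[ a ] * c
·-offset a w c = begin
  a · (λ j → w j + c)                  ≡⟨ Σ-cong (λ j → *-distribˡ-+ (a j) (w j) c) ⟩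
  Σ[ (λ j → a j * w j + a j * c) ]     ≡⟨ Σ-+ (λ j → a j * w j) (λ j → a j * c) ⟩
  a · w + Σ[ (λ j → a j * c) ]         ≡⟨ cong (a · w +_) (Σ-*ʳ a c) ⟩
  a · w + Σ[ a ] * c ∎
  where open ≡-Reasoning

Σ-updateAt-suc : ∀ {k} (a : Fin k → ℕ) j → Σ[ updateAt a j suc ] ≡ suc Σ[ a ]
Σ-updateAt-suc a zero    = refl
Σ-updateAt-suc a (suc j) =
  trans (cong (a zero +_) (Σ-updateAt-suc (Vector.tail a) j)) (+-suc (a zero) _)

·-updateAt-suc : ∀ {k} (a w : Fin k → ℕ) j → updateAt a j suc · w ≡ w j + a · w
·-updateAt-suc a w zero    = +-assoc (w zero) (a zero * w zero) _
·-updateAt-suc a w (suc j) = begin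
  a zero * w zero + updateAt (Vector.tail a) j suc · Vector.tail w
    ≡⟨ cong (a zero * w zero +_) (·-updateAt-suc (Vector.tail a) (Vector.tail w) j) ⟩
  a zero * w zero + (w (suc j) + Vector.tail a · Vector.tail w)
    ≡⟨ +-comm-middle (a zero * w zero) (w (suc j)) _ ⟩
  w (suc j) + a · w ∎
  where
  open ≡-Reasoning
  +-comm-middle : ∀ x y z → x + (y + z) ≡ y + (x + z)
  +-comm-middle = ℕ-Solver.solve-∀

∣Σ : ∀ {k d} (f : Fin k → ℕ) → (∀ j → d ∣ f j) → d ∣ Σ[ f ]
∣Σ {zero}  f d∣f = _ ∣0
∣Σ {suc k} f d∣f = ∣m∣n⇒∣m+n (d∣f zero) (∣Σ (λ j → f (suc j)) (λ j → d∣f (suc j)))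

foldr-gcd∣ : ∀ {k} (f : Fin k → ℕ) j → Vector.foldr gcd 0 f ∣ f j
foldr-gcd∣ f zero    = gcd[m,n]∣m (f zero) _
foldr-gcd∣ f (suc j) = ∣-trans (gcd[m,n]∣n (f zero) _) (foldr-gcd∣ (λ i → f (suc i)) j)

gcdST∣ : ∀ {k₁ k₂} (s : Fin k₁ → ℕ) (t : Fin k₂ → ℕ) j k → gcdST s t ∣ s j + t k
gcdST∣ s t j k = ∣-trans (foldr-gcd∣ _ j) (foldr-gcd∣ (λ k → s j + t k) k)

+-≡+⇒-≡- : ∀ {a b c d} → a + d ≡ c + b → pos a ℤ.- pos b ≡ pos c ℤ.- pos d
+-≡+⇒-≡- {a} {b} {c} {d} e = begin
  pos a ℤ.- pos b                       ≡⟨ add-sub (pos a) (pos b) (pos d) ⟩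
  (pos a ℤ.+ pos d) ℤ.- pos b ℤ.- pos d ≡⟨ cong (λ z → z ℤ.- pos b ℤ.- pos d) (sym (ℤ.pos-+ a d)) ⟩
  pos (a + d) ℤ.- pos b ℤ.- pos d       ≡⟨ cong (λ z → pos z ℤ.- pos b ℤ.- pos d) e ⟩
  pos (c + b) ℤ.- pos b ℤ.- pos d       ≡⟨ cong (λ z → z ℤ.- pos b ℤ.- pos d) (ℤ.pos-+ c b) ⟩
  (pos c ℤ.+ pos b) ℤ.- pos b ℤ.- pos d ≡⟨ add-sub-cancel (pos c) (pos b) (pos d) ⟩
  pos c ℤ.- pos d ∎
  where
  open ≡-Reasoning
  add-sub : ∀ x y z → x ℤ.- y ≡ (x ℤ.+ z) ℤ.- y ℤ.- z
  add-sub = ℤ-Solver.solve-∀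
  add-sub-cancel : ∀ x y z → (x ℤ.+ y) ℤ.- y ℤ.- z ≡ x ℤ.- z
  add-sub-cancel = ℤ-Solver.solve-∀

pos-diff : ∀ {x y p} → y ≡ x + p → pos y ℤ.- pos x ≡ pos p
pos-diff {x} {y} {p} y≡x+p =
  trans (+-≡+⇒-≡- {y} {x} {p} {0} (trans (+-identityʳ y) (trans y≡x+p (+-comm x p)))) (ℤ.+-identityʳ (pos p))

pos-sub-sub : ∀ a b c → pos a ℤ.- pos b ℤ.- pos c ≡ pos a ℤ.- pos (b + c)
pos-sub-sub a b c = trans (lemma (pos a) (pos b) (pos c)) (cong (λ z → pos a ℤ.- z) (sym (ℤ.pos-+ b c)))
  where
  lemma : ∀ x y z → x ℤ.- y ℤ.- z ≡ x ℤ.- (y ℤ.+ z)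
  lemma = ℤ-Solver.solve-∀

pos-split : ∀ {N x y p q} → N + x ≡ y + q → pos N ≡ (pos y ℤ.- pos x ℤ.- pos p) ℤ.+ pos (p + q)
pos-split {N} {x} {y} {p} {q} N+x≡y+q = begin
  pos N                                        ≡⟨ sym (ℤ.+-identityʳ (pos N)) ⟩
  pos N ℤ.- pos 0
    ≡⟨ +-≡+⇒-≡- {N} {0} {y + q} {x} (trans N+x≡y+q (sym (+-identityʳ _))) ⟩
  pos (y + q) ℤ.- pos x                        ≡⟨ cong (ℤ._- pos x) (ℤ.pos-+ y q) ⟩
  pos y ℤ.+ pos q ℤ.- pos x                    ≡⟨ ring (pos y) (pos x) (pos p) (pos q) ⟩
  (pos y ℤ.- pos x ℤ.- pos p) ℤ.+ (pos p ℤ.+ pos q)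
    ≡⟨ cong (λ z → (pos y ℤ.- pos x ℤ.- pos p) ℤ.+ z) (sym (ℤ.pos-+ p q)) ⟩
  (pos y ℤ.- pos x ℤ.- pos p) ℤ.+ pos (p + q) ∎
  where
  open ≡-Reasoning
  ring : ∀ y x p q → y ℤ.+ q ℤ.- x ≡ (y ℤ.- x ℤ.- p) ℤ.+ (p ℤ.+ q)
  ring = ℤ-Solver.solve-∀

pos∣pos : ∀ {m n} → m ∣ n → pos m ℤˢ.∣ pos n
pos∣pos {m} {n} = ℤˢ.∣ᵤ⇒∣ {pos m} {pos n}

n*[1+m]≤k+b⇒n*m≤b : ∀ {n m k b} → n * suc m ≤ k + b → k ≤ n → n * m ≤ b
n*[1+m]≤k+b⇒n*m≤b {n} {m} {k} {b} le k≤n = +-cancelˡ-≤ k (n * m) b (begin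
  k + n * m ≤⟨ +-monoˡ-≤ (n * m) k≤n ⟩
  n + n * m ≡⟨ sym (*-suc n m) ⟩
  n * suc m ≤⟨ le ⟩
  k + b ∎)
  where open ≤-Reasoning

n*[1+m]≤a⇒n*m≤a : ∀ {n m a} → n * suc m ≤ a → n * m ≤ a
n*[1+m]≤a⇒n*m≤a {n} {m} = ≤-trans (*-monoʳ-≤ n (n≤1+n m))

balance⇒quotient : ∀ {V F N q q′} c → .{{_ : NonZero c}} → V ≤ N →
  V + q * c ≡ N + F + q′ * c → Σ ℕ λ a → a * c + V ≡ N + F
balance⇒quotient {V} {F} {N} {q} {q′} c V≤N e = q ∸ q′ , +-cancelʳ-≡ (q′ * c) _ _ rearranged
  where
  q′≤q : q′ ≤ q
  q′≤q = *-cancelʳ-≤ q′ q c (+-cancelˡ-≤ N (q′ * c) (q * c) (begin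
    N + q′ * c         ≤⟨ +-monoˡ-≤ (q′ * c) (m≤m+n N F) ⟩
    N + F + q′ * c     ≡⟨ sym e ⟩
    V + q * c          ≤⟨ +-monoˡ-≤ (q * c) V≤N ⟩
    N + q * c ∎))
    where open ≤-Reasoning
  rearranged : (q ∸ q′) * c + V + q′ * c ≡ N + F + q′ * c
  rearranged = begin
    (q ∸ q′) * c + V + q′ * c   ≡⟨ ring ((q ∸ q′) * c) V (q′ * c) ⟩
    (q ∸ q′) * c + q′ * c + V   ≡⟨ cong (_+ V) (sym (*-distribʳ-+ c (q ∸ q′) q′)) ⟩
    (q ∸ q′ + q′) * c + V       ≡⟨ cong (λ z → z * c + V) (m∸n+n≡m q′≤q) ⟩
    q * c + V                   ≡⟨ +-comm (q * c) V ⟩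
    V + q * c                   ≡⟨ e ⟩
    N + F + q′ * c ∎
    where
    open ≡-Reasoning
    ring : ∀ x y z → x + y + z ≡ x + z + y
    ring = ℕ-Solver.solve-∀

strictMono⇒mono : ∀ {k} (f : Fin k → ℕ) → (∀ a a′ → a Data.Fin.< a′ → f a < f a′) →
  ∀ a a′ → a Data.Fin.≤ a′ → f a ≤ f a′
strictMono⇒mono f mono a a′ a≤a′ with m≤n⇒m<n∨m≡n a≤a′
... | inj₁ a<a′ = <⇒≤ (mono a a′ a<a′)
... | inj₂ a≡a′ = ≤-reflexive (cong f (toℕ-injective a≡a′))

Expressible : ∀ {k₁ k₂} → (Fin k₁ → ℕ) → (Fin k₂ → ℕ) → ℕ → ℤ → Set
Expressible {k₁} {k₂} s t i ℓ = Σ (Fin k₁ → ℕ) λ a → Σ (Fin k₂ → ℕ) λ b →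
  (Σ[ a ] + Σ[ b ] ≡ i) × (ℓ ≡ pos (a · s) ℤ.- pos (b · t))

module _ {n k₁ k₂ : ℕ} {s : Fin k₁ → ℕ} {t : Fin k₂ → ℕ} where

  walk⇒expressible : ∀ {m} {u v : Fin n} → Walk s t m u v → Expressible s t m (vtx v ℤ.- vtx u)
  walk⇒expressible (stay u) = (λ _ → 0) , (λ _ → 0) , cong₂ _+_ (Σ-zero k₁) (Σ-zero k₂) ,
    trans (ℤ.+-inverseʳ (vtx u)) (sym (cong₂ (λ p q → pos p ℤ.- pos q) (Σ-zero k₁) (Σ-zero k₂)))
  walk⇒expressible {u = u} {v} (step {w = w} (inj₁ (j , w-u)) W) with walk⇒expressible W
  ... | a , b , |a|+|b| , v-w = updateAt a j suc , b , size , (begin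
    vtx v ℤ.- vtx u                                  ≡⟨ telescope (vtx v) (vtx w) (vtx u) ⟩
    (vtx v ℤ.- vtx w) ℤ.+ (vtx w ℤ.- vtx u)          ≡⟨ cong₂ ℤ._+_ v-w w-u ⟩
    (pos (a · s) ℤ.- pos (b · t)) ℤ.+ pos (s j)      ≡⟨ add-pos (a · s) (b · t) (s j) ⟩
    pos (s j + a · s) ℤ.- pos (b · t)
      ≡⟨ cong (λ z → pos z ℤ.- pos (b · t)) (sym (·-updateAt-suc a s j)) ⟩
    pos (updateAt a j suc · s) ℤ.- pos (b · t) ∎)
    where
    open ≡-Reasoning
    telescope : ∀ x y z → x ℤ.- z ≡ (x ℤ.- y) ℤ.+ (y ℤ.- z)
    telescope = ℤ-Solver.solve-∀
    add-pos : ∀ p q r → (pos p ℤ.- pos q) ℤ.+ pos r ≡ pos (r + p) ℤ.- pos q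
    add-pos p q r = trans (lemma (pos p) (pos q) (pos r)) (cong (ℤ._- pos q) (sym (ℤ.pos-+ r p)))
      where
      lemma : ∀ x y z → (x ℤ.- y) ℤ.+ z ≡ (z ℤ.+ x) ℤ.- y
      lemma = ℤ-Solver.solve-∀
    size : Σ[ updateAt a j suc ] + Σ[ b ] ≡ suc _
    size = trans (cong (_+ Σ[ b ]) (Σ-updateAt-suc a j)) (cong suc |a|+|b|)
  walk⇒expressible {u = u} {v} (step {w = w} (inj₂ (j , u-w)) W) with walk⇒expressible W
  ... | a , b , |a|+|b| , v-w = a , updateAt b j suc , size , (begin
    vtx v ℤ.- vtx u                                  ≡⟨ telescope (vtx v) (vtx w) (vtx u) ⟩
    (vtx v ℤ.- vtx w) ℤ.- (vtx u ℤ.- vtx w)          ≡⟨ cong₂ ℤ._-_ v-w u-w ⟩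
    (pos (a · s) ℤ.- pos (b · t)) ℤ.- pos (t j)      ≡⟨ sub-pos (a · s) (b · t) (t j) ⟩
    pos (a · s) ℤ.- pos (t j + b · t)
      ≡⟨ cong (λ z → pos (a · s) ℤ.- pos z) (sym (·-updateAt-suc b t j)) ⟩
    pos (a · s) ℤ.- pos (updateAt b j suc · t) ∎)
    where
    open ≡-Reasoning
    size : Σ[ a ] + Σ[ updateAt b j suc ] ≡ suc _
    size = trans (cong (Σ[ a ] +_) (Σ-updateAt-suc b j)) (trans (+-suc _ _) (cong suc |a|+|b|))
    telescope : ∀ x y z → x ℤ.- z ≡ (x ℤ.- y) ℤ.- (z ℤ.- y)
    telescope = ℤ-Solver.solve-∀
    sub-pos : ∀ p q r → (pos p ℤ.- pos q) ℤ.- pos r ≡ pos p ℤ.- pos (r + q)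
    sub-pos p q r = trans (lemma (pos p) (pos q) (pos r)) (cong (λ z → pos p ℤ.- z) (sym (ℤ.pos-+ r q)))
      where
      lemma : ∀ x y z → (x ℤ.- y) ℤ.- z ≡ x ℤ.- (z ℤ.+ y)
      lemma = ℤ-Solver.solve-∀

expressible⇒congruent : ∀ {k₁ k₂} (s : Fin (suc k₁) → ℕ) (t : Fin (suc k₂) → ℕ) {i ℓ} →
  Expressible s t i ℓ → pos (gcdST s t) ℤᵘ.∣ ℓ ℤ.- pos (i * s zero)
expressible⇒congruent s t (a , b , refl , refl) =
  ℤˢ.∣⇒∣ᵤ {pos d} (subst (pos d ℤˢ.∣_) (sym regrouped)
    (ℤˢ.∣m∣n⇒∣m-n (ℤˢ.∣m∣n⇒∣m-n (pos∣pos d∣X) (pos∣pos d∣Y)) (pos∣pos d∣Z)))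
  where
  σ τ d X Y Z iσ : ℕ
  σ = s zero
  τ = t zero
  d = gcdST s t
  X = a · (λ j → s j + τ)
  Y = b · (λ k → t k + σ)
  Z = Σ[ a ] * (σ + τ)
  iσ = (Σ[ a ] + Σ[ b ]) * σ
  d∣X : d ∣ X
  d∣X = ∣Σ _ (λ j → ∣n⇒∣m*n (a j) (gcdST∣ s t j zero))
  d∣Y : d ∣ Y
  d∣Y = ∣Σ _ (λ k → ∣n⇒∣m*n (b k) (subst (d ∣_) (+-comm σ (t k)) (gcdST∣ s t zero k)))
  d∣Z : d ∣ Z
  d∣Z = ∣n⇒∣m*n (Σ[ a ]) (gcdST∣ s t zero zero)
  ring : ∀ A B α β σ τ → A + ((B + β * σ) + α * (σ + τ)) ≡ (A + α * τ) + (B + (α + β) * σ)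
  ring = ℕ-Solver.solve-∀
  regroupedℕ : a · s + (Y + Z) ≡ X + (b · t + iσ)
  regroupedℕ rewrite ·-offset a s τ | ·-offset b t σ = ring (a · s) (b · t) Σ[ a ] Σ[ b ] σ τ
  regrouped : pos (a · s) ℤ.- pos (b · t) ℤ.- pos iσ ≡ pos X ℤ.- pos Y ℤ.- pos Z
  regrouped = begin
    pos (a · s) ℤ.- pos (b · t) ℤ.- pos iσ ≡⟨ pos-sub-sub (a · s) (b · t) iσ ⟩
    pos (a · s) ℤ.- pos (b · t + iσ)       ≡⟨ +-≡+⇒-≡- {a · s} {b · t + iσ} {X} {Y + Z} regroupedℕ ⟩
    pos X ℤ.- pos (Y + Z)                  ≡⟨ sym (pos-sub-sub X Y Z) ⟩
    pos X ℤ.- pos Y ℤ.- pos Z ∎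
    where open ≡-Reasoning

InI⇒vertices : ∀ {n ℓ} → InI (suc n) ℓ → Σ (Fin (suc n)) λ u → Σ (Fin (suc n)) λ v → vtx v ℤ.- vtx u ≡ ℓ
InI⇒vertices {n} {pos m} (_ , ℤ.+<+ m<1+n) =
  zero , fromℕ< m<1+n , trans (cong (λ z → pos z ℤ.- pos 0) (toℕ-fromℕ< m<1+n)) (ℤ.+-identityʳ (pos m))
InI⇒vertices {n} { -[1+ m ]} (ℤ.-<- m<n , _) =
  fromℕ< (s≤s m<n) , zero , cong (λ z → pos 0 ℤ.- pos z) (toℕ-fromℕ< (s≤s m<n))

module Realisation (n : ℕ) {k₁ k₂ : ℕ} (s : Fin (suc k₁) → ℕ) (t : Fin (suc k₂) → ℕ)
  (s+t₁≤n : ∀ j → s j + t zero ≤ n) (s₁+t≤n : ∀ k → s zero + t k ≤ n)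
  ⦃ _ : NonZero (s zero) ⦄ ⦃ _ : NonZero (t zero) ⦄ where

  σ τ : ℕ
  σ = s zero
  τ = t zero

  s<n : ∀ j → s j < n
  s<n j = <-≤-trans (m<m+n (s j) (>-nonZero⁻¹ τ)) (s+t₁≤n j)

  t<n : ∀ k → t k < n
  t<n k = <-≤-trans (m<n+m (t k) (>-nonZero⁻¹ σ)) (s₁+t≤n k)

  -- Walks in D with vertices recorded as naturals; only an up-step needs a bound,
  -- since a down-step never leaves [0, n) once its start lies there.
  data Path : ℕ → ℕ → ℕ → Set where
    stay : ∀ x → Path 0 x x
    up   : ∀ {m x y} j → x + s j < n → Path m (x + s j) y → Path (suc m) x y
    down : ∀ {m x y} k → Path m x y → Path (suc m) (x + t k) y

  Path-cast : ∀ {m m′ x x′ y} → m ≡ m′ → x ≡ x′ → Path m x y → Path m′ x′ y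
  Path-cast refl refl P = P

  _++_ : ∀ {m m′ x y z} → Path m x y → Path m′ y z → Path (m + m′) x z
  stay _     ++ Q = Q
  up j p P   ++ Q = up j p (P ++ Q)
  down k P   ++ Q = down k (P ++ Q)

  Path⇒Walk : ∀ {m x y} → Path m x y → (u v : Fin n) → toℕ u ≡ x → toℕ v ≡ y → Walk s t m u v
  Path⇒Walk (stay _) u v refl v≡u = subst (Walk s t 0 u) (toℕ-injective (sym v≡u)) (stay u)
  Path⇒Walk (up j x+s<n P) u v refl v≡y =
    step (inj₁ (j , pos-diff (toℕ-fromℕ< x+s<n))) (Path⇒Walk P (fromℕ< x+s<n) v (toℕ-fromℕ< x+s<n) v≡y)
  Path⇒Walk (down {x = x} k P) u v u≡x+t v≡y =
    step (inj₂ (k , pos-diff (trans u≡x+t (cong (_+ t k) (sym (toℕ-fromℕ< x<n))))))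
         (Path⇒Walk P (fromℕ< x<n) v (toℕ-fromℕ< x<n) v≡y)
    where
    x<n : x < n
    x<n = ≤-<-trans (m≤m+n x (t k)) (subst (_< n) u≡x+t (toℕ<n u))

  -- Greedily step up by σ while staying below n, otherwise down by τ; the room
  -- for a down-step comes from σ + τ ≤ n.
  balanced-path : ∀ a b x y → y < n → x + a * σ ≡ y + b * τ → Path (a + b) x y
  balanced-path zero zero x y y<n e =
    Path-cast refl (sym (trans (sym (+-identityʳ x)) (trans e (+-identityʳ y)))) (stay y)
  balanced-path zero (suc b) x y y<n e =
    Path-cast refl x≡ (down zero (balanced-path zero b (y + b * τ) y y<n (+-identityʳ _)))
    where
    x≡ : y + b * τ + τ ≡ x
    x≡ = trans (trans (+-assoc y (b * τ) τ) (cong (y +_) (+-comm (b * τ) τ))) (trans (sym e) (+-identityʳ x))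
  balanced-path (suc a) b x y y<n e with x + σ <? n
  ... | yes x+σ<n = up zero x+σ<n (balanced-path a b (x + σ) y y<n (trans (+-assoc x σ (a * σ)) e))
  balanced-path (suc a) zero x y y<n e | no x+σ≮n = ⊥-elim (x+σ≮n (≤-<-trans x+σ≤y y<n))
    where
    x+σ≤y : x + σ ≤ y
    x+σ≤y = ≤-trans (m≤m+n (x + σ) (a * σ)) (≤-reflexive (trans (+-assoc x σ (a * σ)) (trans e (+-identityʳ y))))
  balanced-path (suc a) (suc b) x y y<n e | no x+σ≮n with m≤n⇒∃[o]m+o≡n τ≤x
    where
    τ≤x : τ ≤ x
    τ≤x = +-cancelʳ-≤ σ τ x (≤-trans (≤-reflexive (+-comm τ σ)) (≤-trans (s+t₁≤n zero) (≮⇒≥ x+σ≮n)))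
  ... | x′ , refl = Path-cast (cong suc (sym (+-suc a b))) (+-comm x′ τ) (down zero (balanced-path (suc a) b x′ y y<n e′))
    where
    e′ : x′ + suc a * σ ≡ y + b * τ
    e′ = +-cancelˡ-≡ τ _ _ (trans (sym (+-assoc τ x′ _)) (trans e (ring y τ (b * τ))))
      where
      ring : ∀ p q r → p + (q + r) ≡ q + (p + r)
      ring = ℕ-Solver.solve-∀

  descend : ∀ {x} → x < n → Path (x / τ) x (x % τ)
  descend {x} x<n = balanced-path 0 (x / τ) x (x % τ) (≤-<-trans (m%n≤m x τ) x<n)
                                 (trans (+-identityʳ x) (m≡m%n+[m/n]*n x τ))

  climb : ℕ → ℕ
  climb x = (n ∸ suc x) / σ

  x+climb<n : ∀ {x} → x < n → x + climb x * σ < n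
  x+climb<n {x} x<n = begin-strict
    x + climb x * σ     ≤⟨ +-monoʳ-≤ x (m/n*n≤m (n ∸ suc x) σ) ⟩
    x + (n ∸ suc x)     <⟨ n<1+n _ ⟩
    suc x + (n ∸ suc x) ≡⟨ m+[n∸m]≡n x<n ⟩
    n ∎
    where open ≤-Reasoning

  n≤x+climb+σ : ∀ {x} → x < n → n ≤ x + climb x * σ + σ
  n≤x+climb+σ {x} x<n = begin
    n                                               ≡⟨ sym (m+[n∸m]≡n x<n) ⟩
    suc x + (n ∸ suc x)                             ≡⟨ cong (suc x +_) (m≡m%n+[m/n]*n (n ∸ suc x) σ) ⟩
    suc x + ((n ∸ suc x) % σ + climb x * σ)         ≡⟨ ring x ((n ∸ suc x) % σ) (climb x * σ) ⟩
    x + climb x * σ + suc ((n ∸ suc x) % σ)         ≤⟨ +-monoʳ-≤ (x + climb x * σ) (m%n<n (n ∸ suc x) σ) ⟩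
    x + climb x * σ + σ ∎
    where
    open ≤-Reasoning
    ring : ∀ p q r → suc p + (q + r) ≡ p + r + suc q
    ring = ℕ-Solver.solve-∀

  ascend : ∀ {x} → x < n → Path (climb x) x (x + climb x * σ)
  ascend {x} x<n = Path-cast (+-identityʳ (climb x)) refl
    (balanced-path (climb x) 0 x _ (x+climb<n x<n) (sym (+-identityʳ _)))

  data Move : Set where
    up   : Fin (suc k₁) → Move
    down : Fin (suc k₂) → Move

  rise : List Move → ℕ
  rise []           = 0
  rise (up j ∷ E)   = s j + rise E
  rise (down _ ∷ E) = rise E

  fall : List Move → ℕ
  fall []           = 0
  fall (up _ ∷ E)   = fall E
  fall (down k ∷ E) = t k + fall E

  rise≤ : ∀ E → rise E ≤ length E * n
  rise≤ []           = z≤n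
  rise≤ (up j ∷ E)   = +-mono-≤ (<⇒≤ (s<n j)) (rise≤ E)
  rise≤ (down _ ∷ E) = ≤-trans (rise≤ E) (m≤n+m _ n)

  fall≤ : ∀ E → fall E ≤ length E * n
  fall≤ []           = z≤n
  fall≤ (up _ ∷ E)   = ≤-trans (fall≤ E) (m≤n+m _ n)
  fall≤ (down k ∷ E) = +-mono-≤ (<⇒≤ (t<n k)) (fall≤ E)

  -- Every prescribed move can be scheduled: before an up-step descend to x % τ < τ,
  -- before a down-step ascend above n - σ; the budgets pay for these detours.
  path-with-moves : ∀ E a b x y → x < n → y < n → n * length E ≤ a → n * length E ≤ b →
    x + a * σ + rise E ≡ y + b * τ + fall E → Path (a + b + length E) x y
  path-with-moves [] a b x y _ y<n _ _ e =
    Path-cast (sym (+-identityʳ _)) refl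
      (balanced-path a b x y y<n (trans (sym (+-identityʳ _)) (trans e (+-identityʳ _))))
  path-with-moves (up j ∷ E) a b x y x<n y<n ha hb e with m≤n⇒∃[o]m+o≡n x/τ≤b
    where
    x/τ≤b : x / τ ≤ b
    x/τ≤b = ≤-trans (m/n≤m x τ) (≤-trans (<⇒≤ x<n) (≤-trans (m≤m*n n (suc (length E))) hb))
  ... | b′ , refl = Path-cast (length-eq (x / τ) a b′ (length E)) refl
      (descend x<n ++ up j z+s<n (path-with-moves E a b′ (z + s j) y z+s<n y<n (n*[1+m]≤a⇒n*m≤a {n} ha) hb′ e′))
    where
    z = x % τ
    z+s<n : z + s j < n
    z+s<n = <-≤-trans (+-monoˡ-< (s j) (m%n<n x τ)) (≤-trans (≤-reflexive (+-comm τ (s j))) (s+t₁≤n j))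
    hb′ : n * length E ≤ b′
    hb′ = n*[1+m]≤k+b⇒n*m≤b hb (≤-trans (m/n≤m x τ) (<⇒≤ x<n))
    e′ : z + s j + a * σ + rise E ≡ y + b′ * τ + fall E
    e′ = +-cancelʳ-≡ (x / τ * τ) _ _ (begin
      z + s j + a * σ + rise E + x / τ * τ    ≡⟨ ring₁ z (s j) (a * σ) (rise E) (x / τ * τ) ⟩
      z + x / τ * τ + a * σ + (s j + rise E)  ≡⟨ cong (λ w → w + a * σ + (s j + rise E)) (sym (m≡m%n+[m/n]*n x τ)) ⟩
      x + a * σ + (s j + rise E)              ≡⟨ e ⟩
      y + (x / τ + b′) * τ + fall E           ≡⟨ ring₂ y (x / τ) b′ τ (fall E) ⟩
      y + b′ * τ + fall E + x / τ * τ ∎)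
      where
      open ≡-Reasoning
      ring₁ : ∀ p q r u v → p + q + r + u + v ≡ p + v + r + (q + u)
      ring₁ = ℕ-Solver.solve-∀
      ring₂ : ∀ p k b τ f → p + (k + b) * τ + f ≡ p + b * τ + f + k * τ
      ring₂ = ℕ-Solver.solve-∀
    length-eq : ∀ k a b m → k + suc (a + b + m) ≡ a + (k + b) + suc m
    length-eq = ℕ-Solver.solve-∀
  path-with-moves (down k ∷ E) a b x y x<n y<n ha hb e with m≤n⇒∃[o]m+o≡n climb≤a
    where
    climb≤a : climb x ≤ a
    climb≤a = ≤-trans (m/n≤m (n ∸ suc x) σ) (≤-trans (m∸n≤m n (suc x)) (≤-trans (m≤m*n n (suc (length E))) ha))
  ... | a′ , refl with m≤n⇒∃[o]m+o≡n t≤z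
    where
    t≤z : t k ≤ x + climb x * σ
    t≤z = +-cancelʳ-≤ σ (t k) _ (≤-trans (≤-reflexive (+-comm (t k) σ)) (≤-trans (s₁+t≤n k) (n≤x+climb+σ x<n)))
  ... | z′ , z≡ = Path-cast (length-eq (climb x) a′ b (length E)) refl
      (ascend x<n ++ Path-cast refl (trans (+-comm z′ (t k)) z≡)
        (down k (path-with-moves E a′ b z′ y z′<n y<n ha′ (n*[1+m]≤a⇒n*m≤a {n} hb) e′)))
    where
    z′<n : z′ < n
    z′<n = ≤-<-trans (≤-trans (m≤n+m z′ (t k)) (≤-reflexive z≡)) (x+climb<n x<n)
    ha′ : n * length E ≤ a′
    ha′ = n*[1+m]≤k+b⇒n*m≤b ha (≤-trans (m/n≤m (n ∸ suc x) σ) (m∸n≤m n (suc x)))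
    e′ : z′ + a′ * σ + rise E ≡ y + b * τ + fall E
    e′ = +-cancelʳ-≡ (t k) _ _ (begin
      z′ + a′ * σ + rise E + t k              ≡⟨ ring₁ z′ (a′ * σ) (rise E) (t k) ⟩
      t k + z′ + a′ * σ + rise E              ≡⟨ cong (λ w → w + a′ * σ + rise E) z≡ ⟩
      x + climb x * σ + a′ * σ + rise E       ≡⟨ ring₂ x (climb x) a′ σ (rise E) ⟩
      x + (climb x + a′) * σ + rise E         ≡⟨ e ⟩
      y + b * τ + (t k + fall E)              ≡⟨ ring₃ (y + b * τ) (t k) (fall E) ⟩
      y + b * τ + fall E + t k ∎)
      where
      open ≡-Reasoning
      ring₁ : ∀ p q r u → p + q + r + u ≡ u + p + q + r
      ring₁ = ℕ-Solver.solve-∀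
      ring₂ : ∀ p c a σ r → p + c * σ + a * σ + r ≡ p + (c + a) * σ + r
      ring₂ = ℕ-Solver.solve-∀
      ring₃ : ∀ p q r → p + (q + r) ≡ p + r + q
      ring₃ = ℕ-Solver.solve-∀
    length-eq : ∀ c a b m → c + suc (a + b + m) ≡ c + a + b + suc m
    length-eq = ℕ-Solver.solve-∀

  c : ℕ
  c = σ + τ

  instance
    c-nonZero : NonZero c
    c-nonZero = >-nonZero (<-≤-trans (>-nonZero⁻¹ σ) (m≤m+n σ τ))

  -- A move list E attains r when r ≡ Σ_{e ∈ E} (e + τ) modulo c, where an up-move
  -- counts as s j and a down-move as - t k.
  record Attaining (r : ℕ) : Set where
    constructor attaining
    field
      moves     : List Move
      extra     : ℕ
      extra′    : ℕ
      balanced  : rise moves + length moves * τ + extra * c ≡ r + fall moves + extra′ * c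

  open Attaining

  rise-++ : ∀ E F → rise (E List.++ F) ≡ rise E + rise F
  rise-++ []           F = refl
  rise-++ (up j ∷ E)   F = trans (cong (s j +_) (rise-++ E F)) (sym (+-assoc (s j) _ _))
  rise-++ (down _ ∷ E) F = rise-++ E F

  fall-++ : ∀ E F → fall (E List.++ F) ≡ fall E + fall F
  fall-++ []           F = refl
  fall-++ (up _ ∷ E)   F = fall-++ E F
  fall-++ (down k ∷ E) F = trans (cong (t k +_) (fall-++ E F)) (sym (+-assoc (t k) _ _))

  attaining-cast : ∀ {r r′} → r ≡ r′ → Attaining r → Attaining r′
  attaining-cast r≡r′ (attaining E q p e) = attaining E q p (trans e (cong (λ r → r + fall E + p * c) r≡r′))

  attaining-0 : Attaining 0
  attaining-0 = attaining [] 0 0 refl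

  attaining-+ : ∀ {r r′} → Attaining r → Attaining r′ → Attaining (r + r′)
  attaining-+ {r} {r′} (attaining E q p e) (attaining F q′ p′ f) = attaining (E List.++ F) (q + q′) (p + p′) (begin
    rise (E List.++ F) + length (E List.++ F) * τ + (q + q′) * c
      ≡⟨ cong₂ (λ u v → u + v * τ + (q + q′) * c) (rise-++ E F) (length-++ E) ⟩
    rise E + rise F + (length E + length F) * τ + (q + q′) * c
      ≡⟨ ring₁ (rise E) (rise F) (length E) (length F) τ q q′ c ⟩
    (rise E + length E * τ + q * c) + (rise F + length F * τ + q′ * c)
      ≡⟨ cong₂ _+_ e f ⟩
    (r + fall E + p * c) + (r′ + fall F + p′ * c)
      ≡⟨ ring₂ r r′ (fall E) (fall F) p p′ c ⟩
    r + r′ + (fall E + fall F) + (p + p′) * c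
      ≡⟨ cong (λ u → r + r′ + u + (p + p′) * c) (sym (fall-++ E F)) ⟩
    r + r′ + fall (E List.++ F) + (p + p′) * c ∎)
    where
    open ≡-Reasoning
    ring₁ : ∀ a b x y τ q p c → a + b + (x + y) * τ + (q + p) * c ≡ (a + x * τ + q * c) + (b + y * τ + p * c)
    ring₁ = ℕ-Solver.solve-∀
    ring₂ : ∀ r₁ r₂ a b q p c → (r₁ + a + q * c) + (r₂ + b + p * c) ≡ r₁ + r₂ + (a + b) + (q + p) * c
    ring₂ = ℕ-Solver.solve-∀

  attaining-* : ∀ w {r} → Attaining r → Attaining (w * r)
  attaining-* zero    A = attaining-0
  attaining-* (suc w) A = attaining-+ A (attaining-* w A)

  length-attaining-* : ∀ w {r} (A : Attaining r) → length (moves (attaining-* w A)) ≡ w * length (moves A)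
  length-attaining-* zero    A = refl
  length-attaining-* (suc w) A =
    trans (length-++ (moves A)) (cong (length (moves A) +_) (length-attaining-* w A))

  attaining-drop-multiple : ∀ {r} w → Attaining (r + w * c) → Attaining r
  attaining-drop-multiple {r} w (attaining E q p e) = attaining E q (w + p) (trans e (ring r w (fall E) p c))
    where
    ring : ∀ r w a q c → r + w * c + a + q * c ≡ r + a + (w + q) * c
    ring = ℕ-Solver.solve-∀

  attaining-add-multiple : ∀ {r} w → Attaining r → Attaining (r + w * c)
  attaining-add-multiple {r} w (attaining E q p e) =
    attaining E (q + w) p (trans (ring (rise E + length E * τ) q w c)
                          (trans (cong (_+ w * c) e) (ring′ r (fall E) (p * c) (w * c))))
    where
    ring : ∀ v q w c → v + (q + w) * c ≡ v + q * c + w * c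
    ring = ℕ-Solver.solve-∀
    ring′ : ∀ r f x y → r + f + x + y ≡ r + y + f + x
    ring′ = ℕ-Solver.solve-∀

  c-1 : ℕ
  c-1 = ℕ.pred c

  suc[c-1] : suc c-1 ≡ c
  suc[c-1] = suc-pred c

  -- c - 1 copies of a move list attaining p attain - p modulo c.
  attaining-∸ : ∀ {g p} → Attaining (g + p) → Attaining p → Attaining g
  attaining-∸ {g} {p} G P =
    attaining-drop-multiple p (attaining-cast (ring g p c-1 c suc[c-1]) (attaining-+ G (attaining-* c-1 P)))
    where
    ring : ∀ g p c-1 c → suc c-1 ≡ c → g + p + c-1 * p ≡ g + p * c
    ring g p c-1 .(suc c-1) refl = lemma g p c-1
      where
      lemma : ∀ g p c-1 → g + p + c-1 * p ≡ g + p * suc c-1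
      lemma = ℕ-Solver.solve-∀

  attaining-gcd : ∀ {m m′} → Attaining m → Attaining m′ → Attaining (gcd m m′)
  attaining-gcd {m} {m′} A A′ with Bézout.identity (gcd-GCD m m′)
  ... | Bézout.+- x y eq = attaining-∸ (attaining-cast (sym eq) (attaining-* x A)) (attaining-* y A′)
  ... | Bézout.-+ x y eq = attaining-∸ (attaining-cast (sym eq) (attaining-* y A′)) (attaining-* x A)

  attaining-foldr-gcd : ∀ {K} (f : Fin K → ℕ) → (∀ j → Attaining (f j)) → Attaining (Vector.foldr gcd 0 f)
  attaining-foldr-gcd {zero}  f A = attaining-0
  attaining-foldr-gcd {suc K} f A = attaining-gcd (A zero) (attaining-foldr-gcd (λ j → f (suc j)) (λ j → A (suc j)))

  rise-replicate-down : ∀ m k → rise (replicate m (down k)) ≡ 0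
  rise-replicate-down zero    k = refl
  rise-replicate-down (suc m) k = rise-replicate-down m k

  fall-replicate-down : ∀ m k → fall (replicate m (down k)) ≡ m * t k
  fall-replicate-down zero    k = refl
  fall-replicate-down (suc m) k = cong (t k +_) (fall-replicate-down m k)

  attaining-s+t : ∀ j k → Attaining (s j + t k)
  attaining-s+t j k = attaining (up j ∷ replicate c-1 (down k)) (t k) τ (begin
    s j + rise (replicate c-1 (down k)) + suc (length (replicate c-1 (down k))) * τ + t k * c
      ≡⟨ cong₂ (λ r l → s j + r + suc l * τ + t k * c) (rise-replicate-down c-1 k) (length-replicate c-1) ⟩
    s j + 0 + suc c-1 * τ + t k * c
      ≡⟨ cong (λ z → s j + 0 + suc c-1 * τ + t k * z) (sym suc[c-1]) ⟩
    s j + 0 + suc c-1 * τ + t k * suc c-1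
      ≡⟨ ring (s j) (t k) τ c-1 ⟩
    s j + t k + c-1 * t k + τ * suc c-1
      ≡⟨ cong₂ (λ f z → s j + t k + f + τ * z) (sym (fall-replicate-down c-1 k)) suc[c-1] ⟩
    s j + t k + fall (replicate c-1 (down k)) + τ * c ∎)
    where
    open ≡-Reasoning
    ring : ∀ s t τ m → s + 0 + suc m * τ + t * suc m ≡ s + t + m * t + τ * suc m
    ring = ℕ-Solver.solve-∀

  attaining-gcdST : Attaining (gcdST s t)
  attaining-gcdST = attaining-foldr-gcd _ (λ j → attaining-foldr-gcd _ (attaining-s+t j))

  moves-balance : ∀ {x y i N R F} a K b → N + x ≡ y + i * τ → a * c + (R + K * τ) ≡ N + F →
    b + (a + K) ≡ i → x + a * σ + R ≡ y + b * τ + F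
  moves-balance {x} {y} {i} {N} {R} {F} a K b N+x≡ ac+V≡ b+[a+K]≡i =
    +-cancelʳ-≡ ((a + K) * τ) _ _ (begin
      x + a * σ + R + (a + K) * τ   ≡⟨ ring₁ x a σ τ R K ⟩
      x + (a * c + (R + K * τ))     ≡⟨ cong (x +_) ac+V≡ ⟩
      x + (N + F)                   ≡⟨ ring₂ x N F ⟩
      N + x + F                     ≡⟨ cong (_+ F) N+x≡ ⟩
      y + i * τ + F                 ≡⟨ cong (λ z → y + z * τ + F) (sym b+[a+K]≡i) ⟩
      y + (b + (a + K)) * τ + F     ≡⟨ ring₃ y b (a + K) τ F ⟩
      y + b * τ + F + (a + K) * τ ∎)
    where
    open ≡-Reasoning
    ring₁ : ∀ x a σ τ p K → x + a * σ + p + (a + K) * τ ≡ x + (a * (σ + τ) + (p + K * τ))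
    ring₁ = ℕ-Solver.solve-∀
    ring₂ : ∀ x N e → x + (N + e) ≡ N + x + e
    ring₂ = ℕ-Solver.solve-∀
    ring₃ : ∀ y b m τ e → y + (b + m) * τ + e ≡ y + b * τ + e + m * τ
    ring₃ = ℕ-Solver.solve-∀

  module Bounded (B : ℕ) where

    moves-bound : ∀ E → length E ≤ B → rise E + length E * τ ≤ B * n + B * n
    moves-bound E K≤B = +-mono-≤ (≤-trans (rise≤ E) (*-monoˡ-≤ n K≤B)) (*-mono-≤ K≤B (<⇒≤ (t<n zero)))

    N-bound i-bound M : ℕ
    N-bound = n * B * c + (B * n + B * n)
    i-bound = n + B * n + B * c + n * B * c
    M = n + N-bound + i-bound

    n≤M : n ≤ M
    n≤M = ≤-trans (m≤m+n n N-bound) (m≤m+n (n + N-bound) i-bound)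

    module _ {i x y N} (M≤i : M ≤ i) (x<n : x < n) (y<n : y < n) (N+x≡ : N + x ≡ y + i * τ) where

      N-large : N-bound ≤ N
      N-large = +-cancelʳ-≤ n N-bound N (begin
        N-bound + n ≡⟨ +-comm N-bound n ⟩
        n + N-bound ≤⟨ m≤m+n (n + N-bound) i-bound ⟩
        M           ≤⟨ M≤i ⟩
        i           ≤⟨ m≤m*n i τ ⟩
        i * τ       ≤⟨ m≤n+m (i * τ) y ⟩
        y + i * τ   ≡⟨ sym N+x≡ ⟩
        N + x       ≤⟨ +-monoʳ-≤ N (<⇒≤ x<n) ⟩
        N + n ∎)
        where open ≤-Reasoning

      N-small : N ≤ n + i * τ
      N-small = ≤-trans (m≤m+n N x) (≤-trans (≤-reflexive N+x≡) (+-monoˡ-≤ (i * τ) (<⇒≤ y<n)))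

      i-large : i-bound ≤ i * σ
      i-large = ≤-trans (m≤n+m i-bound (n + N-bound)) (≤-trans M≤i (m≤m*n i σ))

      module _ (E : List Move) (a : ℕ) (K≤B : length E ≤ B) (ac+V≡ : a * c + (rise E + length E * τ) ≡ N + fall E) where

        nK≤a : n * length E ≤ a
        nK≤a = *-cancelʳ-≤ (n * K) a c (+-cancelʳ-≤ V (n * K * c) (a * c) (begin
          n * K * c + V    ≤⟨ +-mono-≤ (*-monoˡ-≤ c (*-monoʳ-≤ n K≤B)) (moves-bound E K≤B) ⟩
          N-bound          ≤⟨ N-large ⟩
          N                ≤⟨ m≤m+n N (fall E) ⟩
          N + fall E       ≡⟨ sym ac+V≡ ⟩
          a * c + V ∎))
          where
          open ≤-Reasoning
          K V : ℕ
          K = length E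
          V = rise E + K * τ

        a+K+nK≤i : a + length E + n * length E ≤ i
        a+K+nK≤i = *-cancelʳ-≤ (a + K + n * K) i c (begin
          (a + K + n * K) * c                 ≡⟨ ring₁ a K n c ⟩
          a * c + (K + n * K) * c             ≤⟨ +-mono-≤ (≤-trans (m≤m+n (a * c) _) (≤-reflexive ac+V≡))
                                                          (*-monoˡ-≤ c (+-mono-≤ K≤B (*-monoʳ-≤ n K≤B))) ⟩
          N + fall E + (B + n * B) * c        ≤⟨ +-monoˡ-≤ _ (+-mono-≤ N-small (≤-trans (fall≤ E) (*-monoˡ-≤ n K≤B))) ⟩
          n + i * τ + B * n + (B + n * B) * c ≡⟨ ring₂ n (i * τ) B c ⟩
          i * τ + i-bound                     ≤⟨ +-monoʳ-≤ (i * τ) i-large ⟩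
          i * τ + i * σ                       ≡⟨ trans (+-comm (i * τ) (i * σ)) (sym (*-distribˡ-+ i σ τ)) ⟩
          i * c ∎)
          where
          open ≤-Reasoning
          K : ℕ
          K = length E
          ring₁ : ∀ a K n c → (a + K + n * K) * c ≡ a * c + (K + n * K) * c
          ring₁ = ℕ-Solver.solve-∀
          ring₂ : ∀ n T B c → n + T + B * n + (B + n * B) * c ≡ T + (n + B * n + B * c + n * B * c)
          ring₂ = ℕ-Solver.solve-∀

      path-from-attaining : (A : Attaining N) → length (moves A) ≤ B → Path i x y
      path-from-attaining (attaining E q q′ bal) K≤B
        with balance⇒quotient {q = q} {q′ = q′} c
               (≤-trans (moves-bound E K≤B) (≤-trans (m≤n+m _ (n * B * c)) N-large)) bal
      ... | a , ac+V≡ = Path-cast lengths refl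
            (path-with-moves E a b x y x<n y<n (nK≤a E a K≤B ac+V≡) nK≤b
              (moves-balance a (length E) b N+x≡ ac+V≡ b+[a+K]≡i))
        where
        b : ℕ
        b = i ∸ (a + length E)
        b+[a+K]≡i : b + (a + length E) ≡ i
        b+[a+K]≡i = m∸n+n≡m (≤-trans (m≤m+n (a + length E) _) (a+K+nK≤i E a K≤B ac+V≡))
        nK≤b : n * length E ≤ b
        nK≤b = m+n≤o⇒m≤o∸n (n * length E)
                 (≤-trans (≤-reflexive (+-comm _ (a + length E))) (a+K+nK≤i E a K≤B ac+V≡))
        lengths : a + b + length E ≡ i
        lengths = trans (ring a b (length E)) b+[a+K]≡i
          where
          ring : ∀ a b k → a + b + k ≡ b + (a + k)
          ring = ℕ-Solver.solve-∀

  max-moves : ℕ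
  max-moves = c * length (moves attaining-gcdST)

  -- A multiple w d of d is w / c copies of c (absorbed by extra) plus w % c < c copies of d.
  short-attaining : ∀ {N} → gcdST s t ∣ N → Σ (Attaining N) λ A → length (moves A) ≤ max-moves
  short-attaining {N} (divides w refl) =
    attaining-cast (sym N≡) (attaining-add-multiple (w / c * gcdST s t) A) ,
    ≤-trans (≤-reflexive (length-attaining-* (w % c) attaining-gcdST)) (*-monoˡ-≤ _ (<⇒≤ (m%n<n w c)))
    where
    A = attaining-* (w % c) attaining-gcdST
    N≡ : w * gcdST s t ≡ w % c * gcdST s t + w / c * gcdST s t * c
    N≡ = trans (cong (_* gcdST s t) (m≡m%n+[m/n]*n w c)) (ring (w % c) (w / c) c (gcdST s t))
      where
      ring : ∀ r h c d → (r + h * c) * d ≡ r * d + h * d * c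
      ring = ℕ-Solver.solve-∀

  open Bounded max-moves public using (M; n≤M)
  open Bounded max-moves using (path-from-attaining)

  path-of-length : ∀ {i x y N} → M ≤ i → x < n → y < n → gcdST s t ∣ N → N + x ≡ y + i * τ → Path i x y
  path-of-length M≤i x<n y<n d∣N N+x≡ =
    let A , K≤B = short-attaining d∣N in path-from-attaining M≤i x<n y<n N+x≡ A K≤B

  congruent⇒walk : ∀ {i} → M ≤ i → (u v : Fin n) →
    pos (gcdST s t) ℤᵘ.∣ (vtx v ℤ.- vtx u) ℤ.- pos (i * σ) → Walk s t i u v
  congruent⇒walk {i} M≤i u v d∣ = Path⇒Walk (path-of-length M≤i (toℕ<n u) (toℕ<n v) d∣N N+x≡) u v refl refl
    where
    d x y N : ℕ
    d = gcdST s t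
    x = toℕ u
    y = toℕ v
    N = y + i * τ ∸ x
    N+x≡ : N + x ≡ y + i * τ
    N+x≡ = m∸n+n≡m (≤-trans (<⇒≤ (toℕ<n u))
             (≤-trans n≤M (≤-trans M≤i (≤-trans (m≤m*n i τ) (m≤n+m (i * τ) y)))))
    d∣i[σ+τ] : d ∣ i * σ + i * τ
    d∣i[σ+τ] = subst (d ∣_) (*-distribˡ-+ i σ τ) (∣n⇒∣m*n i (gcdST∣ s t zero zero))
    d∣N : d ∣ N
    d∣N = ℤˢ.∣⇒∣ᵤ {pos d} {pos N} (subst (pos d ℤˢ.∣_) (sym (pos-split {N} {x} {y} {i * σ} {i * τ} N+x≡))
            (ℤˢ.∣m∣n⇒∣m+n (ℤˢ.∣ᵤ⇒∣ {pos d} {vtx v ℤ.- vtx u ℤ.- pos (i * σ)} d∣)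
                          (pos∣pos d∣i[σ+τ])))

theorem2p9 : (n k₁ k₂ : ℕ) → 2 ≤ n →
    (s : Fin (suc k₁) → ℕ) → (t : Fin (suc k₂) → ℕ) →
    (∀ a → 1 ≤ s a × s a Data.Nat.< n) → (∀ b → 1 ≤ t b × t b Data.Nat.< n) →
    (∀ a a′ → a Data.Fin.< a′ → s a Data.Nat.< s a′) →
    (∀ b b′ → b Data.Fin.< b′ → t b Data.Nat.< t b′) →
    s (fromℕ k₁) + t zero ≤ n → s zero + t (fromℕ k₂) ≤ n →
    Σ ℕ λ M → 1 ≤ M × (∀ i → M ≤ i → ∀ (ℓ : ℤ) →
    (P n s t i ℓ ⇔ Q n s t i ℓ) × (Q n s t i ℓ ⇔ R n s t i ℓ))
theorem2p9 n@(suc _) k₁ k₂ _ s t s-range t-range s-mono t-mono sₖ+t₁≤n s₁+tₖ≤n =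
  M , s≤s z≤n , λ i M≤i ℓ → mk⇔ (R⇒Q ∘ P⇒R M≤i) Q⇒P , mk⇔ (P⇒R M≤i ∘ Q⇒P) R⇒Q
  where
  instance
    s₁-nonZero : NonZero (s zero)
    s₁-nonZero = >-nonZero (proj₁ (s-range zero))
    t₁-nonZero : NonZero (t zero)
    t₁-nonZero = >-nonZero (proj₁ (t-range zero))
  s+t₁≤n : ∀ j → s j + t zero ≤ n
  s+t₁≤n j = ≤-trans (+-monoˡ-≤ (t zero) (strictMono⇒mono s s-mono j (fromℕ k₁) (≤fromℕ j))) sₖ+t₁≤n
  s₁+t≤n : ∀ k → s zero + t k ≤ n
  s₁+t≤n k = ≤-trans (+-monoʳ-≤ (s zero) (strictMono⇒mono t t-mono k (fromℕ k₂) (≤fromℕ k))) s₁+tₖ≤n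
  open Realisation n s t s+t₁≤n s₁+t≤n using (M; congruent⇒walk)
  P⇒R : ∀ {i ℓ} → M ≤ i → P n s t i ℓ → R n s t i ℓ
  P⇒R {i} M≤i (ℓ∈I , d∣) = ℓ∈I , λ u v v-u≡ℓ →
    congruent⇒walk M≤i u v (subst (λ z → pos (gcdST s t) ℤᵘ.∣ z ℤ.- pos (i * s zero)) (sym v-u≡ℓ) d∣)
  Q⇒P : ∀ {i ℓ} → Q n s t i ℓ → P n s t i ℓ
  Q⇒P (ℓ∈I , e) = ℓ∈I , expressible⇒congruent s t e
  R⇒Q : ∀ {i ℓ} → R n s t i ℓ → Q n s t i ℓ
  R⇒Q {i} (ℓ∈I , walk) = let u , v , v-u≡ℓ = InI⇒vertices ℓ∈I in
    ℓ∈I , subst (Expressible s t i) v-u≡ℓ (walk⇒expressible (walk u v v-u≡ℓ))
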